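{- Let $T\in\mathcal{PT}(n)$ and $1\le i<j\le n$. If the zigzag paths $P_i$ and $P_j$ of $T$ intersect, then they intersect only at points and share no edge; moreover, every intersection point other than the first one (in the order along the paths) corresponds to a cell of $T$ filled with $1$.
   Context: A partition $\lambda=(\lambda_1,\dots,\lambda_r)$ with $\lambda_1\ge\cdots\ge\lambda_r\ge 0$ (zero parts allowed) has Ferrers diagram the left-justified array with $\lambda_i$ cells in row $i$; its length $n$ is the total number of rows (including empty rows) and columns. The $n$ unit steps of the south-east boundary of the diagram are labeled $1,\dots,n$ from north-east to south-west; a row is labeled $i$ if it contains the vertical (south-going) boundary step labeled $i$ at its right end, and a column is labeled $j$ if it contains the horizontal (west-going) boundary step labeled $j$ at its bottom. A permutation tableau of length $n$ is a $0,1$-filling of such a Ferrers diagram of length $n$ such that (1) each column contains at least one $1$, and (2) no $0$ has simultaneously a $1$ above it in its column and a $1$ to its left in its row; $\mathcal{PT}(n)$ is the set of them. For a label $i$, the zigzag path $P_i$ enters the tableau from the left of row $i$ (if $i$ is a row label, travelling east) or from the top of column $i$ (if $i$ is a column label, travelling south), and moves east or south through the cells, changing direction (east to south or south to east) each time it meets a cell containing $1$, until it exits the diagram through a boundary step. -}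

module Defs where

open import Data.Nat using (ℕ; zero; suc; _+_; _∸_; _<?_) renaming (_<_ to _<ℕ_)
open import Data.Fin using (Fin; toℕ; fromℕ<; _<_)
open import Data.Bool using (Bool; true; false; not; if_then_else_)
open import Data.Product using (Σ; ∃-syntax; _×_; _,_; proj₁; proj₂)
open import Data.Product.Properties using (≡-dec)
open import Data.List using (List; []; _∷_; map; filter)
open import Data.List.Membership.Propositional using (_∈_)
import Data.List.Membership.DecPropositional as DecMem
open import Data.Sum using (_⊎_)
open import Data.Empty using (⊥)
open import Relation.Nullary using (yes; no)
open import Relation.Binary.PropositionalEquality using (_≡_)
import Data.Nat as N

-- Labels 1..n of the paper are represented by Fin n (0-based), order preserved.
-- A Ferrers diagram of length n is given by its boundary word: isRow k = true
-- iff boundary step k is vertical (a row label), false iff horizontal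
-- (a column label).

IsCell : ∀ {n} → (Fin n → Bool) → Fin n → Fin n → Set
IsCell isRow i j = isRow i ≡ true × isRow j ≡ false × i < j

-- Permutation tableau of length n.  'fill i j' is only meaningful when
-- IsCell isRow i j holds (true = 1, false = 0); other values are ignored.
-- Row i' is above row i iff i' < i; column j' is left of column j iff j < j'.
record PT (n : ℕ) : Set where
  field
    isRow : Fin n → Bool
    fill  : Fin n → Fin n → Bool
    colOne : ∀ j → isRow j ≡ false →
             ∃[ i ] (IsCell isRow i j × fill i j ≡ true)
    leCond : ∀ i j → IsCell isRow i j → fill i j ≡ false →
             ∀ i' → IsCell isRow i' j → i' < i → fill i' j ≡ true →
             ∀ j' → IsCell isRow i j' → j < j' → fill i j' ≡ true → ⊥

open PT public

-- extension of Fin-indexed data to ℕ (false out of range; never used there)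
ext₁ : ∀ {n} → (Fin n → Bool) → ℕ → Bool
ext₁ {n} f k with k <? n
... | yes p = f (fromℕ< p)
... | no _  = false

ext₂ : ∀ {n} → (Fin n → Fin n → Bool) → ℕ → ℕ → Bool
ext₂ {n} f k l with k <? n | l <? n
... | yes p | yes q = f (fromℕ< p) (fromℕ< q)
... | _     | _     = false

isRowℕ isColℕ : ∀ {n} → PT n → ℕ → Bool
isRowℕ T = ext₁ (isRow T)
isColℕ T = ext₁ (λ x → not (isRow T x))

fillℕ : ∀ {n} → PT n → ℕ → ℕ → Bool
fillℕ T = ext₂ (fill T)

data Dir : Set where
  E S : Dir

flipDir : Dir → Dir
flipDir E = S
flipDir S = E

Cell : Set
Cell = ℕ × ℕ          -- (row label , column label)

-- a visit of a path to a cell, together with the direction in which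
-- the path enters that cell
Visit : Set
Visit = Cell × Dir

mutual
  -- travelling east in row r; the remaining candidate columns are
  -- r+k, r+k-1, ..., r+1 (west to east)
  east : ∀ {n} → PT n → ℕ → ℕ → List Visit
  east T r zero = []
  east T r (suc k) =
    if isColℕ T (r + suc k)
    then ((r , r + suc k) , E) ∷
           (if fillℕ T r (r + suc k) then south T (r + suc k) k else east T r k)
    else east T r k

  -- travelling south in column c; the remaining candidate rows are
  -- c-k, c-k+1, ..., c-1 (north to south)
  south : ∀ {n} → PT n → ℕ → ℕ → List Visit
  south T c zero = []
  south T c (suc k) =
    if isRowℕ T (c ∸ suc k)
    then ((c ∸ suc k , c) , S) ∷
           (if fillℕ T (c ∸ suc k) c then east T (c ∸ suc k) k else south T c k)
    else south T c k

-- the zigzag path P_i, as the list of visited cells in order along the path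
-- (with entry direction); the path then exits through a boundary step
zigzag : ∀ {n} → PT n → Fin n → List Visit
zigzag {n} T i =
  if isRow T i then east T (toℕ i) (n ∸ suc (toℕ i)) else south T (toℕ i) (toℕ i)

exitDir : ∀ {n} → PT n → Visit → Dir
exitDir T ((r , c) , d) = if fillℕ T r c then flipDir d else d

-- two paths share an edge: they traverse a common half-segment of some cell,
-- i.e. enter the same cell from the same side or leave it through the same side
SharesEdge : ∀ {n} → PT n → List Visit → List Visit → Set
SharesEdge T P Q = ∃[ v ] ∃[ w ] (v ∈ P × w ∈ Q × proj₁ v ≡ proj₁ w ×
                    (proj₂ v ≡ proj₂ w ⊎ exitDir T v ≡ exitDir T w))

private
  _≟c_ : (x y : Cell) → Relation.Nullary.Dec (x ≡ y)
  _≟c_ = ≡-dec N._≟_ N._≟_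

open DecMem _≟c_ using (_∈?_)

commonCells : List Visit → List Visit → List Cell
commonCells P Q = filter (λ x → x ∈? map proj₁ Q) (map proj₁ P)

-- A visit determines the previous one: it lies in the same column at the nearest row label
-- above, or in the same row at the nearest column label to the west, and its entry side is
-- recovered from its exit side and its filling.  Tracing two paths back from a common visit
-- thus leads to a common starting label, so distinct paths never enter a cell from the same
-- side; as the exit side determines the entry side, they share no edge.
-- Suppose P_i and P_j meet at z and later at a 0-cell y (paths only move east and south, so
-- z precedes y on both).  They cross y in different directions, P southward and Q eastward,
-- say.  By the Le-condition the column above y or the row west of y holds only 0s.  In the
-- first case P came straight down that column, so it enters z from the north and z holds a 0;
-- Q cannot leave z eastward and come back to the column of y, so it also enters z from the
-- north: a common visit.  The row case is symmetric.
module Submission where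

open import Defs
open import Level using (0ℓ)
open import Data.Nat using (ℕ; zero; suc; _+_; _∸_; _≤_; z≤n; z<s; _<?_) renaming (_<_ to _<ℕ_)
open import Data.Nat.Properties
open import Data.Fin using (Fin; toℕ; fromℕ<; _<_)
open import Data.Fin.Properties using (fromℕ<-toℕ; toℕ-fromℕ<; toℕ<n)
open import Data.Bool using (Bool; true; false; not)
open import Data.Bool.Properties using (not-¬; not-injective) renaming (_≟_ to _≟ᵇ_)
open import Data.Product using (∃; ∃₂; _×_; _,_; proj₁; proj₂; map₂)
open import Data.Sum using (_⊎_; inj₁; inj₂)
open import Data.Maybe.Relation.Unary.All as Maybe using (just; nothing)
open import Data.List using (List; []; _∷_; map; filter; drop; head)
open import Data.List.Relation.Unary.All as All using (All; []; _∷_)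
open import Data.List.Relation.Unary.Any using (here; there)
open import Data.List.Relation.Unary.Linked as Linked using (Linked; []; [-]; _∷_)
open import Data.List.Membership.Propositional using (_∈_)
open import Data.List.Membership.Propositional.Properties using (∈-map⁻; ∈-filter⁻)
open import Relation.Binary using (Rel; tri<; tri≈; tri>)
open import Relation.Unary using (Pred; Decidable)
open import Relation.Nullary using (¬_; yes; no; _×-dec_)
open import Relation.Binary.PropositionalEquality
open import Data.Empty using (⊥; ⊥-elim)

module _ {A : Set} where

  data Before : List A → A → A → Set where
    here≺  : ∀ {x y xs} → y ∈ xs → Before (x ∷ xs) x y
    there≺ : ∀ {x y z xs} → Before xs x y → Before (z ∷ xs) x y

  Before⇒∈ˡ : ∀ {xs x y} → Before xs x y → x ∈ xs
  Before⇒∈ˡ (here≺ _)  = here refl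
  Before⇒∈ˡ (there≺ b) = there (Before⇒∈ˡ b)

  Before⇒∈ʳ : ∀ {xs x y} → Before xs x y → y ∈ xs
  Before⇒∈ʳ (here≺ y∈)  = there y∈
  Before⇒∈ʳ (there≺ b) = there (Before⇒∈ʳ b)

  ∈-trichotomy : ∀ {xs x y} → x ∈ xs → y ∈ xs → Before xs x y ⊎ x ≡ y ⊎ Before xs y x
  ∈-trichotomy (here refl) (here refl) = inj₂ (inj₁ refl)
  ∈-trichotomy (here refl) (there y∈)  = inj₁ (here≺ y∈)
  ∈-trichotomy (there x∈)  (here refl) = inj₂ (inj₂ (here≺ x∈))
  ∈-trichotomy (there x∈)  (there y∈) with ∈-trichotomy x∈ y∈
  ... | inj₁ b          = inj₁ (there≺ b)
  ... | inj₂ (inj₁ x≡y) = inj₂ (inj₁ x≡y)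
  ... | inj₂ (inj₂ b)   = inj₂ (inj₂ (there≺ b))

  All-drop-filter : ∀ {P Q : Pred A 0ℓ} (P? : Decidable P) xs →
                    (∀ {x y} → Before xs x y → P x → P y → Q y) →
                    All Q (drop 1 (filter P? xs))
  All-drop-filter P? []       _     = []
  All-drop-filter P? (x ∷ xs) later with P? x
  ... | yes Px = All.tabulate λ y∈ → let y∈xs , Py = ∈-filter⁻ P? y∈ in later (here≺ y∈xs) Px Py
  ... | no _   = All-drop-filter P? xs (λ b → later (there≺ b))

module _ {A B : Set} where

  Before-map⁻ : (f : A → B) → ∀ {xs u w} → Before (map f xs) u w →
                ∃₂ λ x y → Before xs x y × f x ≡ u × f y ≡ w
  Before-map⁻ f {x ∷ xs} (here≺ w∈) with ∈-map⁻ f w∈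
  ... | y , y∈ , refl = x , y , here≺ y∈ , refl , refl
  Before-map⁻ f {x ∷ xs} (there≺ b) with Before-map⁻ f b
  ... | y , z , b′ , fy , fz = y , z , there≺ b′ , fy , fz

Source : {A : Set} → Rel A 0ℓ → A → Set
Source R x = ∀ p → ¬ R p x

module _ {A : Set} {R : Rel A 0ℓ} where

  linked-∷ : ∀ {x xs} → Maybe.All (R x) (head xs) → Linked R xs → Linked R (x ∷ xs)
  linked-∷ {xs = []}    _          _ = [-]
  linked-∷ {xs = _ ∷ _} (just Rxy) l = Rxy ∷ l

  predecessor : ∀ {x xs y} → Linked R (x ∷ xs) → y ∈ xs → ∃ λ p → p ∈ x ∷ xs × R p y
  predecessor (Rxy ∷ _) (here refl) = _ , here refl , Rxy
  predecessor (_ ∷ l)   (there y∈) with predecessor l y∈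
  ... | p , p∈ , Rpy = p , there p∈ , Rpy

  module _ {Q : Rel A 0ℓ} (R⇒Q : ∀ {x y} → R x y → Q x y)
           (R∘Q⇒Q : ∀ {x y z} → R x y → Q y z → Q x z) where

    linked-∈⇒ : ∀ {x xs y} → Linked R (x ∷ xs) → y ∈ xs → Q x y
    linked-∈⇒ (Rxy ∷ _) (here refl) = R⇒Q Rxy
    linked-∈⇒ (Rxy ∷ l) (there z∈)  = R∘Q⇒Q Rxy (linked-∈⇒ l z∈)

    linked-Before⇒ : ∀ {xs x y} → Linked R xs → Before xs x y → Q x y
    linked-Before⇒ l (here≺ y∈) = linked-∈⇒ l y∈
    linked-Before⇒ l (there≺ b) = linked-Before⇒ (Linked.tail l) b

  module _ (R-injectiveˡ : ∀ {x y z} → R x z → R y z → x ≡ y) where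

    meet⇒nested : ∀ {x xs y ys v} → Linked R (x ∷ xs) → Linked R (y ∷ ys) →
                  v ∈ x ∷ xs → v ∈ y ∷ ys → x ∈ y ∷ ys ⊎ y ∈ x ∷ xs
    meet⇒nested _ _ (here refl) v∈′        = inj₁ v∈′
    meet⇒nested _ _ (there v∈)  (here refl) = inj₂ (there v∈)
    meet⇒nested (Rxx′ ∷ l) (Ryy′ ∷ l′) (there v∈) (there v∈′) with meet⇒nested l l′ v∈ v∈′
    ... | inj₁ x′∈ with predecessor (Ryy′ ∷ l′) x′∈
    ...   | p , p∈ , Rpx′ = inj₁ (subst (_∈ _) (R-injectiveˡ Rpx′ Rxx′) p∈)
    meet⇒nested (Rxx′ ∷ l) (Ryy′ ∷ l′) (there v∈) (there v∈′)
      | inj₂ y′∈ with predecessor (Rxx′ ∷ l) y′∈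
    ...   | p , p∈ , Rpy′ = inj₂ (subst (_∈ _) (R-injectiveˡ Rpy′ Ryy′) p∈)

    meet⇒sources-equal : ∀ {x xs y ys v} → Linked R (x ∷ xs) → Linked R (y ∷ ys) →
                         Source R x → Source R y → v ∈ x ∷ xs → v ∈ y ∷ ys → x ≡ y
    meet⇒sources-equal l l′ src src′ v∈ v∈′ with meet⇒nested l l′ v∈ v∈′
    ... | inj₁ (here x≡y) = x≡y
    ... | inj₂ (here y≡x) = sym y≡x
    ... | inj₁ (there x∈) = let p , _ , Rpx = predecessor l′ x∈ in ⊥-elim (src p Rpx)
    ... | inj₂ (there y∈) = let p , _ , Rpy = predecessor l y∈ in ⊥-elim (src′ p Rpy)

module _ {n : ℕ} where

  ext₁-toℕ : (f : Fin n → Bool) (i : Fin n) → ext₁ f (toℕ i) ≡ f i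
  ext₁-toℕ f i with toℕ i <? n
  ... | yes i<n = cong f (fromℕ<-toℕ i i<n)
  ... | no  i≮n = ⊥-elim (i≮n (toℕ<n i))

  ext₂-toℕ : (f : Fin n → Fin n → Bool) (i j : Fin n) → ext₂ f (toℕ i) (toℕ j) ≡ f i j
  ext₂-toℕ f i j with toℕ i <? n | toℕ j <? n
  ... | yes i<n | yes j<n = cong₂ f (fromℕ<-toℕ i i<n) (fromℕ<-toℕ j j<n)
  ... | no  i≮n | _       = ⊥-elim (i≮n (toℕ<n i))
  ... | yes _   | no  j≮n = ⊥-elim (j≮n (toℕ<n j))

  ext₁-true : (f : Fin n → Bool) {x : ℕ} → ext₁ f x ≡ true → ∃ λ i → toℕ i ≡ x × f i ≡ true
  ext₁-true f {x} fx with x <? n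
  ... | yes x<n = fromℕ< x<n , toℕ-fromℕ< x<n , fx
  ... | no _ with () ← fx

Dir-clash : E ≡ S → ⊥
Dir-clash ()

flipDir-injective : ∀ {d d′} → flipDir d ≡ flipDir d′ → d ≡ d′
flipDir-injective {E} {E} _ = refl
flipDir-injective {S} {S} _ = refl

module Paths {n} (T : PT n) where

  isColℕ-toℕ : (j : Fin n) → isColℕ T (toℕ j) ≡ not (isRow T j)
  isColℕ-toℕ = ext₁-toℕ (λ x → not (isRow T x))

  column-label : ∀ {x} → isColℕ T x ≡ true → ∃ λ j → toℕ j ≡ x × isRow T j ≡ false
  column-label x-col with ext₁-true (λ x → not (isRow T x)) x-col
  ... | j , refl , not-row = j , refl , not-injective not-row

  column-label-< : ∀ {x} → isColℕ T x ≡ true → x <ℕ n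
  column-label-< x-col with column-label x-col
  ... | j , refl , _ = toℕ<n j

  Valid : Cell → Set
  Valid (r , c) = isRowℕ T r ≡ true × isColℕ T c ≡ true × r <ℕ c

  leCondℕ : ∀ {r c r′ c′} → Valid (r , c) → fillℕ T r c ≡ false →
            r′ <ℕ r → isRowℕ T r′ ≡ true → fillℕ T r′ c ≡ true →
            c <ℕ c′ → isColℕ T c′ ≡ true → fillℕ T r c′ ≡ true → ⊥
  leCondℕ (r-row , c-col , r<c) rc-0 r′<r r′-row r′c-1 c<c′ c′-col rc′-1
    with ext₁-true (isRow T) r-row | column-label c-col | ext₁-true (isRow T) r′-row | column-label c′-col
  ... | i , refl , i-row | j , refl , j-col | i′ , refl , i′-row | j′ , refl , j′-col =
    leCond T i j (i-row , j-col , r<c) (fill≡ i j rc-0)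
      i′ (i′-row , j-col , <-trans r′<r r<c) r′<r (fill≡ i′ j r′c-1)
      j′ (i-row , j′-col , <-trans r<c c<c′) c<c′ (fill≡ i j′ rc′-1)
    where
    fill≡ : ∀ {b} i j → fillℕ T (toℕ i) (toℕ j) ≡ b → fill T i j ≡ b
    fill≡ i j = trans (sym (ext₂-toℕ (fill T) i j))

  RowClearWest ColumnClearAbove : Cell → Set
  RowClearWest     (r , c) = ∀ c′ → c <ℕ c′ → isColℕ T c′ ≡ true → fillℕ T r c′ ≡ false
  ColumnClearAbove (r , c) = ∀ r′ → r′ <ℕ r → isRowℕ T r′ ≡ true → fillℕ T r′ c ≡ false

  rowClearWest⊎columnClearAbove : ∀ {y} → Valid y → fillℕ T (proj₁ y) (proj₂ y) ≡ false →
                                  RowClearWest y ⊎ ColumnClearAbove y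
  rowClearWest⊎columnClearAbove {r , c} vy y-0
    with anyUpTo? (λ x → isRowℕ T x ≟ᵇ true ×-dec fillℕ T x c ≟ᵇ true) r
  ... | yes (r′ , r′<r , r′-row , r′c-1) = inj₁ row-clear
    where
    row-clear : RowClearWest (r , c)
    row-clear c′ c<c′ c′-col with fillℕ T r c′ in rc′
    ... | false = refl
    ... | true  = ⊥-elim (leCondℕ vy y-0 r′<r r′-row r′c-1 c<c′ c′-col rc′)
  ... | no none-above = inj₂ column-clear
    where
    column-clear : ColumnClearAbove (r , c)
    column-clear r′ r′<r r′-row with fillℕ T r′ c in r′c
    ... | false = refl
    ... | true  = ⊥-elim (none-above (r′ , r′<r , r′-row , r′c))

  exitDir-injective : ∀ c {d d′} → exitDir T (c , d) ≡ exitDir T (c , d′) → d ≡ d′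
  exitDir-injective (r , c) eq with fillℕ T r c
  ... | true  = flipDir-injective eq
  ... | false = eq

  exitDir-0 : ∀ {r c} d → fillℕ T r c ≡ false → exitDir T ((r , c) , d) ≡ d
  exitDir-0 d rc-0 rewrite rc-0 = refl

  exitDir-1 : ∀ {r c} d → fillℕ T r c ≡ true → exitDir T ((r , c) , d) ≡ flipDir d
  exitDir-1 d rc-1 rewrite rc-1 = refl

  NoColumnBetween NoRowBetween : ℕ → ℕ → Set
  NoColumnBetween a b = ∀ x → a <ℕ x → x <ℕ b → isColℕ T x ≡ false
  NoRowBetween    a b = ∀ x → a <ℕ x → x <ℕ b → isRowℕ T x ≡ false

  data Next : Visit → Visit → Set where
    eastStep  : ∀ {r c c′ d} → Valid (r , c) → exitDir T ((r , c) , d) ≡ E →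
            c′ <ℕ c → NoColumnBetween c′ c → Next ((r , c) , d) ((r , c′) , E)
    southStep : ∀ {r r′ c d} → Valid (r , c) → exitDir T ((r , c) , d) ≡ S →
            r <ℕ r′ → NoRowBetween r r′ → Next ((r , c) , d) ((r′ , c) , S)

  Next-injectiveˡ : ∀ {a b v} → Next a v → Next b v → a ≡ b
  Next-injectiveˡ (eastStep {c = c₁} (_ , c₁-col , _) exit₁ c′<c₁ gap₁)
                  (eastStep {c = c₂} (_ , c₂-col , _) exit₂ c′<c₂ gap₂) with <-cmp c₁ c₂
  ... | tri< c₁<c₂ _ _ = ⊥-elim (not-¬ c₁-col (gap₂ c₁ c′<c₁ c₁<c₂))
  ... | tri> _ _ c₂<c₁ = ⊥-elim (not-¬ c₂-col (gap₁ c₂ c′<c₂ c₂<c₁))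
  ... | tri≈ _ refl _  = cong (_ ,_) (exitDir-injective _ (trans exit₁ (sym exit₂)))
  Next-injectiveˡ (southStep {r = r₁} (r₁-row , _) exit₁ r₁<r′ gap₁)
                  (southStep {r = r₂} (r₂-row , _) exit₂ r₂<r′ gap₂) with <-cmp r₁ r₂
  ... | tri< r₁<r₂ _ _ = ⊥-elim (not-¬ r₂-row (gap₁ r₂ r₁<r₂ r₂<r′))
  ... | tri> _ _ r₂<r₁ = ⊥-elim (not-¬ r₁-row (gap₂ r₁ r₂<r₁ r₁<r′))
  ... | tri≈ _ refl _  = cong (_ ,_) (exitDir-injective _ (trans exit₁ (sym exit₂)))

  data Ahead : Visit → Cell → Set where
    eastward  : ∀ {r c d r′ c′} → exitDir T ((r , c) , d) ≡ E → r ≤ r′ → c′ <ℕ c →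
                Ahead ((r , c) , d) (r′ , c′)
    southward : ∀ {r c d r′ c′} → exitDir T ((r , c) , d) ≡ S → r <ℕ r′ → c′ ≤ c →
                Ahead ((r , c) , d) (r′ , c′)

  Next⇒Ahead : ∀ {a b} → Next a b → Ahead a (proj₁ b)
  Next⇒Ahead (eastStep _ exit c′<c _)  = eastward exit ≤-refl c′<c
  Next⇒Ahead (southStep _ exit r<r′ _) = southward exit r<r′ ≤-refl

  Ahead⇒≤ : ∀ {r c d r′ c′} → Ahead ((r , c) , d) (r′ , c′) → r ≤ r′ × c′ ≤ c
  Ahead⇒≤ (eastward _ r≤r′ c′<c)  = r≤r′ , <⇒≤ c′<c
  Ahead⇒≤ (southward _ r<r′ c′≤c) = <⇒≤ r<r′ , c′≤c

  Next-Ahead-trans : ∀ {a b z} → Next a b → Ahead b z → Ahead a z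
  Next-Ahead-trans (eastStep _ exit c′<c _) b≺z =
    let r≤ , ≤c′ = Ahead⇒≤ b≺z in eastward exit r≤ (≤-<-trans ≤c′ c′<c)
  Next-Ahead-trans (southStep _ exit r<r′ _) b≺z =
    let r′≤ , ≤c = Ahead⇒≤ b≺z in southward exit (<-≤-trans r<r′ r′≤) ≤c

  Ahead-asym : ∀ {a b} → Ahead a (proj₁ b) → Ahead b (proj₁ a) → ⊥
  Ahead-asym {b = (_ , _) , _} (eastward _ _ c′<c) b≺a  = <⇒≱ c′<c (proj₂ (Ahead⇒≤ b≺a))
  Ahead-asym {b = (_ , _) , _} (southward _ r<r′ _) b≺a = <⇒≱ r<r′ (proj₁ (Ahead⇒≤ b≺a))

  Before⇒Ahead : ∀ {L a b} → Linked Next L → Before L a b → Ahead a (proj₁ b)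
  Before⇒Ahead = linked-Before⇒ Next⇒Ahead Next-Ahead-trans

  Before-transfer : ∀ {P Q z e e′ y d d′} → Linked Next P → Linked Next Q →
                    Before P (z , e) (y , d) → (z , e′) ∈ Q → (y , d′) ∈ Q →
                    Before Q (z , e′) (y , d′)
  Before-transfer lP lQ zy z∈ y∈ with ∈-trichotomy z∈ y∈
  ... | inj₁ zy′        = zy′
  ... | inj₂ (inj₁ refl) = ⊥-elim (Ahead-asym (Before⇒Ahead lP zy) (Before⇒Ahead lP zy))
  ... | inj₂ (inj₂ yz′) = ⊥-elim (Ahead-asym (Before⇒Ahead lP zy) (Before⇒Ahead lQ yz′))

  ZeroWestOf : Visit → Visit → Set
  ZeroWestOf ((r , c) , d) ((r′ , c′) , _) = r ≡ r′ × c′ <ℕ c × d ≡ E × fillℕ T r c ≡ false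

  ZeroNorthOf : Visit → Visit → Set
  ZeroNorthOf ((r , c) , d) ((r′ , c′) , _) = c ≡ c′ × r <ℕ r′ × d ≡ S × fillℕ T r c ≡ false

  AlongClearRow AlongClearColumn : Visit → Visit → Set
  AlongClearRow    a b = proj₂ b ≡ E → RowClearWest (proj₁ b) → ZeroWestOf a b
  AlongClearColumn a b = proj₂ b ≡ S → ColumnClearAbove (proj₁ b) → ZeroNorthOf a b

  Next⇒AlongClearRow : ∀ {a b} → Next a b → AlongClearRow a b
  Next⇒AlongClearRow (eastStep {d = d} (_ , c-col , _) exit c′<c _) refl clear =
    refl , c′<c , trans (sym (exitDir-0 d rc-0)) exit , rc-0
    where rc-0 = clear _ c′<c c-col

  Next-AlongClearRow-trans : ∀ {a b z} → Next a b → AlongClearRow b z → AlongClearRow a z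
  Next-AlongClearRow-trans {b = (_ , _) , _} {z = (_ , _) , _} a→b b→z refl clear
    with b→z refl clear
  ... | refl , c′<c , refl , _ with Next⇒AlongClearRow a→b refl (λ x c<x → clear x (<-trans c′<c c<x))
  ...   | refl , c<cₐ , refl , a-0 = refl , <-trans c′<c c<cₐ , refl , a-0

  Next⇒AlongClearColumn : ∀ {a b} → Next a b → AlongClearColumn a b
  Next⇒AlongClearColumn (southStep {d = d} (r-row , _) exit r<r′ _) refl clear =
    refl , r<r′ , trans (sym (exitDir-0 d rc-0)) exit , rc-0
    where rc-0 = clear _ r<r′ r-row

  Next-AlongClearColumn-trans : ∀ {a b z} → Next a b → AlongClearColumn b z → AlongClearColumn a z
  Next-AlongClearColumn-trans {b = (_ , _) , _} {z = (_ , _) , _} a→b b→z refl clear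
    with b→z refl clear
  ... | refl , r<r′ , refl , _ with Next⇒AlongClearColumn a→b refl (λ x x<r → clear x (<-trans x<r r<r′))
  ...   | refl , rₐ<r , refl , a-0 = refl , <-trans rₐ<r r<r′ , refl , a-0

  crossing-same-entry : ∀ {P Q y z e e′} → Valid y → fillℕ T (proj₁ y) (proj₂ y) ≡ false →
                        Linked Next P → Linked Next Q →
                        Before P (z , e) (y , S) → Before Q (z , e′) (y , E) → e ≡ e′
  crossing-same-entry vy y-0 lP lQ zyP zyQ with rowClearWest⊎columnClearAbove vy y-0
  ... | inj₁ row-clear
    with linked-Before⇒ Next⇒AlongClearRow Next-AlongClearRow-trans lQ zyQ refl row-clear
  ...   | refl , _ , refl , z-0 with Before⇒Ahead lP zyP
  ...     | eastward {d = E} _ _ _      = refl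
  ...     | eastward {d = S} exit _ _   = ⊥-elim (Dir-clash (trans (sym exit) (exitDir-0 S z-0)))
  ...     | southward _ r<r _           = ⊥-elim (<-irrefl refl r<r)
  crossing-same-entry vy y-0 lP lQ zyP zyQ | inj₂ column-clear
    with linked-Before⇒ Next⇒AlongClearColumn Next-AlongClearColumn-trans lP zyP refl column-clear
  ...   | refl , _ , refl , z-0 with Before⇒Ahead lQ zyQ
  ...     | southward {d = S} _ _ _     = refl
  ...     | southward {d = E} exit _ _  = ⊥-elim (Dir-clash (trans (sym (exitDir-0 E z-0)) exit))
  ...     | eastward _ _ c<c            = ⊥-elim (<-irrefl refl c<c)

  Chain : List Visit → Set
  Chain L = Linked Next L × All (λ v → Valid (proj₁ v)) L

  chain-∷ : ∀ {v L} → Valid (proj₁ v) → Maybe.All (Next v) (head L) → Chain L → Chain (v ∷ L)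
  chain-∷ vv hd (l , valid) = linked-∷ hd l , vv ∷ valid

  data EntersRow (r p : ℕ) : Visit → Set where
    entersRow : ∀ {c} → c <ℕ p → NoColumnBetween c p → EntersRow r p ((r , c) , E)

  data EntersColumn (q c : ℕ) : Visit → Set where
    entersColumn : ∀ {r} → q ≤ r → (∀ x → q ≤ x → x <ℕ r → isRowℕ T x ≡ false) →
                   EntersColumn q c ((r , c) , S)

  entersRow-last : ∀ r c → EntersRow r (suc c) ((r , c) , E)
  entersRow-last r c = entersRow ≤-refl λ x c<x x≤c → ⊥-elim (<⇒≱ c<x (≤-pred x≤c))

  entersColumn-first : ∀ q c → EntersColumn q c ((q , c) , S)
  entersColumn-first q c = entersColumn ≤-refl λ x q≤x x<q → ⊥-elim (<⇒≱ x<q q≤x)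

  EntersRow-extend : ∀ {r p h} → isColℕ T p ≡ false → EntersRow r p h → EntersRow r (suc p) h
  EntersRow-extend p-not-col (entersRow c<p gap) = entersRow (≤-trans c<p (n≤1+n _)) gap′
    where
    gap′ : NoColumnBetween _ (suc _)
    gap′ x c<x x<sp with m≤n⇒m<n∨m≡n (≤-pred x<sp)
    ... | inj₁ x<p  = gap x c<x x<p
    ... | inj₂ refl = p-not-col

  EntersColumn-extend : ∀ {q c h} → isRowℕ T q ≡ false → EntersColumn (suc q) c h → EntersColumn q c h
  EntersColumn-extend q-not-row (entersColumn q<r gap) = entersColumn (<⇒≤ q<r) gap′
    where
    gap′ : ∀ x → _ ≤ x → x <ℕ _ → isRowℕ T x ≡ false
    gap′ x q≤x x<r with m≤n⇒m<n∨m≡n q≤x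
    ... | inj₁ q<x  = gap x q<x x<r
    ... | inj₂ refl = q-not-row

  mutual
    east-chain : ∀ k {r} → isRowℕ T r ≡ true →
                 Chain (east T r k) × Maybe.All (EntersRow r (r + suc k)) (head (east T r k))
    east-chain zero    _    = ([] , []) , nothing
    east-chain (suc k) {r} r-row rewrite +-suc r (suc k) with isColℕ T (r + suc k) in c-col
    ... | false = map₂ (Maybe.map (EntersRow-extend c-col)) (east-chain k r-row)
    ... | true with fillℕ T r (r + suc k) in rc
    ...   | true  = let ch , hd = south-chain k (sym (+-suc r k)) c-col
                    in chain-∷ vc (Maybe.map turn hd) ch , just (entersRow-last r (r + suc k))
      where
      vc = r-row , c-col , m<m+n r z<s
      turn : ∀ {h} → EntersColumn (suc r) (r + suc k) h → Next ((r , r + suc k) , E) h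
      turn (entersColumn r<r′ gap) = southStep vc (exitDir-1 E rc) r<r′ gap
    ...   | false = let ch , hd = east-chain k r-row
                    in chain-∷ vc (Maybe.map straight hd) ch , just (entersRow-last r (r + suc k))
      where
      vc = r-row , c-col , m<m+n r z<s
      straight : ∀ {h} → EntersRow r (r + suc k) h → Next ((r , r + suc k) , E) h
      straight (entersRow c′<c gap) = eastStep vc (exitDir-0 E rc) c′<c gap

    south-chain : ∀ k {q c} → q + k ≡ c → isColℕ T c ≡ true →
                  Chain (south T c k) × Maybe.All (EntersColumn q c) (head (south T c k))
    south-chain zero    _ _ = ([] , []) , nothing
    south-chain (suc k) {q} {c} q+k≡c c-col with c ∸ suc k | c∸k≡q
      where
      c∸k≡q : c ∸ suc k ≡ q
      c∸k≡q = trans (cong (_∸ suc k) (sym q+k≡c)) (m+n∸n≡m q (suc k))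
    ... | .q | refl with isRowℕ T q in q-row
    ...   | false = map₂ (Maybe.map (EntersColumn-extend q-row)) (south-chain k q+k≡c′ c-col)
      where q+k≡c′ = trans (sym (+-suc q k)) q+k≡c
    ...   | true with fillℕ T q c in qc
    ...     | true  = let ch , hd = east-chain k q-row
                      in chain-∷ vc (Maybe.map turn hd) ch , just (entersColumn-first q c)
      where
      vc = q-row , c-col , subst (q <ℕ_) q+k≡c (m<m+n q z<s)
      turn : ∀ {h} → EntersRow q (q + suc k) h → Next ((q , c) , S) h
      turn (entersRow c′<c gap) =
        eastStep vc (exitDir-1 S qc) (subst (_ <ℕ_) q+k≡c c′<c) (subst (NoColumnBetween _) q+k≡c gap)
    ...     | false = let ch , hd = south-chain k (trans (sym (+-suc q k)) q+k≡c) c-col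
                      in chain-∷ vc (Maybe.map straight hd) ch , just (entersColumn-first q c)
      where
      vc = q-row , c-col , subst (q <ℕ_) q+k≡c (m<m+n q z<s)
      straight : ∀ {h} → EntersColumn (suc q) c h → Next ((q , c) , S) h
      straight (entersColumn q<r′ gap) = southStep vc (exitDir-0 S qc) q<r′ gap

  EntersRow-source : ∀ {r h} → EntersRow r n h → Source Next h
  EntersRow-source (entersRow _ gap) _ (eastStep (_ , cw-col , _) _ c<cw _) =
    not-¬ cw-col (gap _ c<cw (column-label-< cw-col))

  EntersColumn-source : ∀ {c h} → EntersColumn 0 c h → Source Next h
  EntersColumn-source (entersColumn _ gap) _ (southStep (rw-row , _) _ rw<r _) =
    not-¬ rw-row (gap _ z≤n rw<r)

  entryLabel : Visit → ℕ
  entryLabel ((r , _) , E) = r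
  entryLabel ((_ , c) , S) = c

  Starts : Fin n → Visit → Set
  Starts i h = Source Next h × entryLabel h ≡ toℕ i

  zigzag-chain : ∀ i → Chain (zigzag T i) × Maybe.All (Starts i) (head (zigzag T i))
  zigzag-chain i with isRow T i in i-row
  ... | true =
    map₂ (Maybe.map starts) (east-chain (n ∸ suc (toℕ i)) (trans (ext₁-toℕ (isRow T) i) i-row))
    where
    ends-at-n : toℕ i + suc (n ∸ suc (toℕ i)) ≡ n
    ends-at-n = trans (+-suc (toℕ i) _) (m+[n∸m]≡n (toℕ<n i))
    starts : ∀ {h} → EntersRow (toℕ i) (toℕ i + suc (n ∸ suc (toℕ i))) h → Starts i h
    starts {h} enters@(entersRow _ _) =
      EntersRow-source (subst (λ p → EntersRow (toℕ i) p h) ends-at-n enters) , refl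
  ... | false =
    map₂ (Maybe.map starts) (south-chain (toℕ i) refl (trans (isColℕ-toℕ i) (cong not i-row)))
    where
    starts : ∀ {h} → EntersColumn 0 (toℕ i) h → Starts i h
    starts enters@(entersColumn _ _) = EntersColumn-source enters , refl

  zigzag-linked : ∀ i → Linked Next (zigzag T i)
  zigzag-linked i = proj₁ (proj₁ (zigzag-chain i))

  zigzag-valid : ∀ i {v} → v ∈ zigzag T i → Valid (proj₁ v)
  zigzag-valid i = All.lookup (proj₂ (proj₁ (zigzag-chain i)))

  zigzag-disjoint : ∀ {i j v} → toℕ i ≢ toℕ j → v ∈ zigzag T i → v ∈ zigzag T j → ⊥
  zigzag-disjoint {i} {j} i≢j v∈ v∈′
    with zigzag T i | zigzag-chain i | zigzag T j | zigzag-chain j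
  ... | _ ∷ _ | (l , _) , just (src , lab) | _ ∷ _ | (l′ , _) , just (src′ , lab′) =
    i≢j (trans (sym lab) (trans (cong entryLabel same-source) lab′))
    where same-source = meet⇒sources-equal Next-injectiveˡ l l′ src src′ v∈ v∈′

  no-second-meeting-at-0 : ∀ {i j z e e′ y d d′} → toℕ i ≢ toℕ j →
                           fillℕ T (proj₁ y) (proj₂ y) ≡ false →
                           Before (zigzag T i) (z , e) (y , d) →
                           Before (zigzag T j) (z , e′) (y , d′) → ⊥
  no-second-meeting-at-0 {d = E} {E} i≢j _ zy zy′ =
    zigzag-disjoint i≢j (Before⇒∈ʳ zy) (Before⇒∈ʳ zy′)
  no-second-meeting-at-0 {d = S} {S} i≢j _ zy zy′ =
    zigzag-disjoint i≢j (Before⇒∈ʳ zy) (Before⇒∈ʳ zy′)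
  no-second-meeting-at-0 {i} {j} {d = S} {E} i≢j y-0 zy zy′
    with refl ← crossing-same-entry (zigzag-valid j (Before⇒∈ʳ zy′)) y-0
                                    (zigzag-linked i) (zigzag-linked j) zy zy′ =
    zigzag-disjoint i≢j (Before⇒∈ˡ zy) (Before⇒∈ˡ zy′)
  no-second-meeting-at-0 {i} {j} {d = E} {S} i≢j y-0 zy zy′
    with refl ← crossing-same-entry (zigzag-valid j (Before⇒∈ʳ zy′)) y-0
                                    (zigzag-linked j) (zigzag-linked i) zy′ zy =
    zigzag-disjoint i≢j (Before⇒∈ˡ zy) (Before⇒∈ˡ zy′)

  second-meeting-filled : ∀ {i j z e e′ y d d′} → toℕ i ≢ toℕ j →
                          Before (zigzag T i) (z , e) (y , d) →
                          (z , e′) ∈ zigzag T j → (y , d′) ∈ zigzag T j →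
                          fillℕ T (proj₁ y) (proj₂ y) ≡ true
  second-meeting-filled {i} {j} {y = r , c} i≢j zy z∈ y∈ with fillℕ T r c in y-fill
  ... | true  = refl
  ... | false = ⊥-elim (no-second-meeting-at-0 i≢j y-fill zy zy′)
    where zy′ = Before-transfer (zigzag-linked i) (zigzag-linked j) zy z∈ y∈

proposition2p2 : ∀ {n} (T : PT n) (i j : Fin n) → i < j →
    commonCells (zigzag T i) (zigzag T j) ≢ [] →
    ¬ SharesEdge T (zigzag T i) (zigzag T j) ×
    All (λ x → fillℕ T (proj₁ x) (proj₂ x) ≡ true)
        (drop 1 (commonCells (zigzag T i) (zigzag T j)))
proposition2p2 T i j i<j _ = no-shared-edge , All-drop-filter _ (map proj₁ (zigzag T i)) filled
  where
  open Paths T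
  i≢j : toℕ i ≢ toℕ j
  i≢j = <⇒≢ i<j
  no-shared-edge : ¬ SharesEdge T (zigzag T i) (zigzag T j)
  no-shared-edge ((y , d) , (.y , d′) , v∈ , v∈′ , refl , same-side) =
    zigzag-disjoint i≢j v∈ (subst (λ d → (y , d) ∈ zigzag T j) (sym (same-entry same-side)) v∈′)
    where
    same-entry : d ≡ d′ ⊎ exitDir T (y , d) ≡ exitDir T (y , d′) → d ≡ d′
    same-entry (inj₁ d≡d′)  = d≡d′
    same-entry (inj₂ exits) = exitDir-injective y exits
  filled : ∀ {z y} → Before (map proj₁ (zigzag T i)) z y → z ∈ map proj₁ (zigzag T j) →
           y ∈ map proj₁ (zigzag T j) → fillℕ T (proj₁ y) (proj₂ y) ≡ true
  filled zy z∈ y∈ with Before-map⁻ proj₁ zy | ∈-map⁻ proj₁ z∈ | ∈-map⁻ proj₁ y∈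
  ... | _ , _ , zy′ , refl , refl | _ , z∈′ , refl | _ , y∈′ , refl =
    second-meeting-filled i≢j zy′ z∈′ y∈′
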